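{- Let $k$ be a positive integer, let $M(k)=\binom{k}{\lfloor k/2\rfloor}$, and let $\Delta^-,\Delta^+\geq -1$ be integers. (i) If $\Delta^-+\Delta^+\leq M(k)-2$, then $c(\Delta^-,\Delta^+)\leq k$. (ii) If $\max\{\Delta^-,\Delta^+\}> M(k)-1$, then $c(\Delta^-,\Delta^+)>k$. (iii) If $\Delta^-+\Delta^+> M(k+1)-2$, then $c(\Delta^-,\Delta^+)>k$.
   Context: A digraph $D=(V,A)$ (finite) is covered by $k$ cuts if there are $U_1,\dots,U_k\subseteq V$ such that every arc $uv\in A$ has some $a$ with $u\in U_a$, $v\notin U_a$; equivalently, there is a labeling $C:V\to\mathcal{P}(\{1,\dots,k\})$ with $C(u)\not\subseteq C(v)$ for every arc $uv$. For integers $\Delta^-,\Delta^+\geq -1$, $\mathcal{D}(\Delta^-,\Delta^+)$ is the class of all finite acyclic digraphs in which every vertex has indegree at most $\Delta^-$ or outdegree at most $\Delta^+$, and $c(\Delta^-,\Delta^+)$ is the smallest $k$ such that every digraph in $\mathcal{D}(\Delta^-,\Delta^+)$ is covered by $k$ cuts. -}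

module Defs where

open import Data.Nat using (ℕ; zero; suc; _/_)
open import Data.Nat.Combinatorics using (_C_)
open import Data.Bool using (Bool; true; false)
open import Data.Fin using (Fin)
open import Data.Fin.Subset using (Subset; _∈_; _∉_)
open import Data.Integer using (ℤ; +_; _≤_)
open import Data.Product using (Σ; ∃; _×_)
open import Data.Sum using (_⊎_)
open import Relation.Binary.PropositionalEquality using (_≡_)
open import Relation.Nullary using (¬_)

Digraph : ℕ → Set
Digraph n = Fin n → Fin n → Bool

Arc : ∀ {n} → Digraph n → Fin n → Fin n → Set
Arc D u v = D u v ≡ true

data Walk⁺ {n} (D : Digraph n) : Fin n → Fin n → Set where
  one  : ∀ {u v} → Arc D u v → Walk⁺ D u v
  _∷_  : ∀ {u v w} → Arc D u v → Walk⁺ D v w → Walk⁺ D u w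

Acyclic : ∀ {n} → Digraph n → Set
Acyclic D = ∀ v → ¬ Walk⁺ D v v

count : ∀ {n} → (Fin n → Bool) → ℕ
count {zero} f = 0
count {suc n} f with f Fin.zero
... | true  = suc (count {n} (λ i → f (Fin.suc i)))
... | false = count {n} (λ i → f (Fin.suc i))

indeg : ∀ {n} → Digraph n → Fin n → ℕ
indeg D v = count (λ u → D u v)

outdeg : ∀ {n} → Digraph n → Fin n → ℕ
outdeg D u = count (λ v → D u v)

InClass : ℤ → ℤ → ∀ {n} → Digraph n → Set
InClass Δ⁻ Δ⁺ D = Acyclic D × (∀ v → (+ indeg D v ≤ Δ⁻) ⊎ (+ outdeg D v ≤ Δ⁺))

CoveredBy : ℕ → ∀ {n} → Digraph n → Set
CoveredBy k {n} D = Σ (Fin k → Subset n) λ U →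
  ∀ u v → Arc D u v → ∃ λ a → (u ∈ U a) × (v ∉ U a)

-- c(Δ⁻,Δ⁺) ≤ k : every digraph of the class is covered by k cuts.
c≤ : ℤ → ℤ → ℕ → Set
c≤ Δ⁻ Δ⁺ k = ∀ n (D : Digraph n) → InClass Δ⁻ Δ⁺ D → CoveredBy k D

-- c(Δ⁻,Δ⁺) > k : some digraph of the class is not covered by k cuts.
c> : ℤ → ℤ → ℕ → Set
c> Δ⁻ Δ⁺ k = Σ ℕ λ n → Σ (Digraph n) λ D → InClass Δ⁻ Δ⁺ D × ¬ CoveredBy k D

M : ℕ → ℕ
M k = k C (k / 2)

{-# OPTIONS --safe #-}
module Submission where

-- Covering by k cuts amounts to labelling the vertices by subsets of {1,…,k} so that no
-- arc goes from a set to one of its supersets.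
--
-- (i) The vertices of indegree < a are coloured greedily along a topological order with a
-- colours, the remaining ones (of outdegree < b) along the reverse order with b further
-- colours. Adjacent vertices get distinct colours, and a + b ≤ M(k) colours can be sent to
-- distinct ⌊k/2⌋-subsets, which are pairwise incomparable.
--
-- (ii), (iii) In the digraphs used here an In-vertex may take any ≤ p earlier In-vertices
-- as in-neighbours, an Out-vertex any ≤ q earlier Out-vertices as out-neighbours, and every
-- In-vertex points to every Out-vertex. Cover the label space (the subsets of {1,…,k}, or
-- in the mixed case of {0,…,k} with the kind recorded in coordinate 0) by M symmetric
-- chains. In each chain, the highest label already used may belong to an Out-vertex, or
-- the lowest one to an In-vertex, but not both: the In-vertex would point to the
-- Out-vertex while its label lies below. So there are at most q such Out-vertices or at
-- most p such In-vertices, and a new vertex adjacent to exactly these must get an unused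
-- label, for its chain would otherwise already have a used label above (below) it.
-- This cannot be repeated more often than there are labels.

open import Defs

module CutCovers where

  open import Data.Bool using (Bool; true; false; _∧_; _∨_; not; if_then_else_) renaming (_≟_ to _≟ᵇ_)
  open import Data.Bool.Properties using (∧-conicalˡ; ∧-conicalʳ; ∧-identityʳ; not-injective)
  open import Data.Empty using (⊥; ⊥-elim)
  open import Data.Fin as Fin using (Fin; zero; suc; toℕ; fromℕ<)
  open import Data.Fin.Properties as Finₚ using (any?; all?; ¬∀⟶∃¬; pigeonhole; toℕ<n; toℕ-fromℕ<)
  open import Data.Fin.Subset using (Subset; _⊆_; _⊇_; _⊈_; ∁; ∣_∣; inside; outside) renaming (_∈_ to _∈ₛ_; _∉_ to _∉ₛ_)
  open import Data.Fin.Subset.Properties using (_∈?_; x∈p⇒x∉∁p; x∉p⇒x∈∁p; drop-∷-⊆; p⊆q⇒∣p∣≤∣q∣; ⊆-refl; out⊆; s⊆s)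
  open import Data.List as List using (List; []; _∷_; _++_; map; length; mapMaybe)
  open import Data.List.Membership.Propositional using (_∈_; find)
  open import Data.List.Membership.Propositional.Properties using (∈-map⁺; ∈-map⁻; ∈-++⁻; ∈-lookup)
  open import Data.List.Properties using (length-map; length-++; map-++; length-mapMaybe)
  open import Data.List.Relation.Unary.All as All using (All; []; _∷_)
  import Data.List.Relation.Unary.All.Properties as All
  open import Data.List.Relation.Unary.AllPairs as AllPairs using (AllPairs; []; _∷_)
  import Data.List.Relation.Unary.AllPairs.Properties as AllPairs
  open import Data.List.Relation.Unary.Any as Any using (Any; here; there)
  import Data.List.Relation.Unary.Any.Properties as Any
  open import Data.Maybe using (Maybe; just; nothing)
  open import Data.Nat as ℕ using (ℕ; zero; suc; _+_; _*_; _∸_; _^_; _≤_; _<_; z≤n; s≤s; _≤?_; _<?_; _/_)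
  open import Data.List.Membership.DecPropositional ℕ._≟_ using () renaming (_∈?_ to _∈ℕ?_)
  open import Data.Nat.Combinatorics using (_C_; nCk+nC[k+1]≡[n+1]C[k+1])
  open import Data.Nat.DivMod using (m*n/n≡m; /-monoˡ-≤; m<n*o⇒m/o<n)
  open import Data.Nat.ListAction using (sum)
  open import Data.Nat.ListAction.Properties using (sum-++)
  open import Data.Nat.Properties
  open import Algebra.Properties.CommutativeSemigroup +-commutativeSemigroup using (interchange)
  open import Data.Product using (Σ; ∃; _×_; _,_; proj₁; proj₂; map₂; swap)
  open import Data.Sum using (_⊎_; inj₁; inj₂)
  open import Data.Unit using (⊤; tt)
  open import Data.Vec as Vec using (tabulate; lookup; []; _∷_)
  open import Data.Vec.Properties using (lookup∘tabulate; []=⇒lookup; lookup⇒[]=; ≡-dec)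
  open import Function using (_∘_; const; case_of_)
  open import Level using (0ℓ)
  open import Relation.Binary using (Rel; Symmetric)
  open import Relation.Binary.PropositionalEquality
  open import Relation.Nullary using (¬_; Dec; yes; no; does; contradiction)
  open import Relation.Nullary.Decidable using (dec-true; dec-false; _×-dec_; _→-dec_)

  from-does : ∀ {A : Set} (a? : Dec A) → does a? ≡ true → A
  from-does (yes a) _ = a

  ∧-intro : ∀ {a b} → a ≡ true → b ≡ true → a ∧ b ≡ true
  ∧-intro refl refl = refl

  ∧-monoˡ-true : ∀ {a a′ b} → (a ≡ true → a′ ≡ true) → a ∧ b ≡ true → a′ ∧ b ≡ true
  ∧-monoˡ-true {true} {a′} {true} a⇒a′ _ = trans (∧-identityʳ a′) (a⇒a′ refl)

  count-mono : ∀ {n} {f g : Fin n → Bool} → (∀ i → f i ≡ true → g i ≡ true) → count f ≤ count g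
  count-mono {zero} _ = z≤n
  count-mono {suc n} {f} {g} f⇒g with f zero in f₀ | g zero in g₀
  ... | true  | true  = s≤s (count-mono (f⇒g ∘ suc))
  ... | false | true  = m≤n⇒m≤1+n (count-mono (f⇒g ∘ suc))
  ... | false | false = count-mono (f⇒g ∘ suc)
  ... | true  | false = contradiction (trans (sym (f⇒g zero f₀)) g₀) λ ()

  count-∧≤ʳ : ∀ {n} (f g : Fin n → Bool) → count (λ i → f i ∧ g i) ≤ count g
  count-∧≤ʳ f g = count-mono λ i → ∧-conicalʳ (f i) (g i)

  count≤n : ∀ {n} (f : Fin n → Bool) → count f ≤ n
  count≤n {zero} f = z≤n
  count≤n {suc n} f with f zero
  ... | true  = s≤s (count≤n (f ∘ suc))
  ... | false = m≤n⇒m≤1+n (count≤n (f ∘ suc))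

  count-false : ∀ {n} (f : Fin n → Bool) → (∀ i → f i ≡ false) → count f ≡ 0
  count-false {zero} f _ = refl
  count-false {suc n} f none with f zero | none zero
  ... | false | _ = count-false (f ∘ suc) (none ∘ suc)

  count-∨ : ∀ {n} (f g : Fin n → Bool) → count (λ i → f i ∨ g i) ≤ count f + count g
  count-∨ {zero} f g = z≤n
  count-∨ {suc n} f g with f zero | g zero
  ... | true  | true  = s≤s (≤-trans (count-∨ (f ∘ suc) (g ∘ suc)) (+-monoʳ-≤ (count (f ∘ suc)) (n≤1+n _)))
  ... | true  | false = s≤s (count-∨ (f ∘ suc) (g ∘ suc))
  ... | false | true  = ≤-trans (s≤s (count-∨ (f ∘ suc) (g ∘ suc))) (≤-reflexive (sym (+-suc _ _)))
  ... | false | false = count-∨ (f ∘ suc) (g ∘ suc)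

  count-singleton : ∀ {n} m → count {n} (λ i → does (toℕ i ≟ m)) ≤ 1
  count-singleton {zero} m = z≤n
  count-singleton {suc n} zero = s≤s (≤-reflexive (count-false {n} _ λ _ → refl))
  count-singleton {suc n} (suc m) = count-singleton {n} m

  count-remove : ∀ {n} (f : Fin n → Bool) {j} → f j ≡ true → count (λ i → f i ∧ not (does (i Finₚ.≟ j))) < count f
  count-remove {suc n} f {zero} fj rewrite fj = s≤s (count-mono {n} {λ i → f (suc i) ∧ true} λ i → ∧-conicalˡ _ _)
  count-remove {suc n} f {suc j} fj with f zero
  ... | true  = s≤s (count-remove (f ∘ suc) fj)
  ... | false = count-remove (f ∘ suc) fj

  count<n⇒∃false : ∀ {n} (f : Fin n → Bool) → count f < n → ∃ λ i → f i ≡ false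
  count<n⇒∃false {suc n} f c<n with f zero in f₀
  ... | false = zero , f₀
  ... | true with count<n⇒∃false (f ∘ suc) (≤-pred c<n)
  ...   | i , fi = suc i , fi

  count-∈ : ∀ {n} xs → count {n} (λ u → does (toℕ u ∈ℕ? xs)) ≤ length xs
  count-∈ {n} []       = ≤-reflexive (count-false {n} _ λ _ → refl)
  count-∈ {n} (x ∷ xs) = ≤-trans (count-∨ {n} (λ u → does (toℕ u ≟ x)) (λ u → does (toℕ u ∈ℕ? xs)))
                                 (+-mono-≤ (count-singleton {n} x) (count-∈ {n} xs))

  AllPairs-lookup : ∀ {A : Set} {R : Rel A 0ℓ} → Symmetric R → ∀ {xs} → AllPairs R xs →
                    ∀ {i j} → i ≢ j → R (List.lookup xs i) (List.lookup xs j)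
  AllPairs-lookup sym (_ ∷ _)     {zero}  {zero}  i≢j = ⊥-elim (i≢j refl)
  AllPairs-lookup sym (x∼xs ∷ _)  {zero}  {suc j} _   = All.lookup x∼xs (∈-lookup j)
  AllPairs-lookup sym (x∼xs ∷ _)  {suc i} {zero}  _   = sym (All.lookup x∼xs (∈-lookup i))
  AllPairs-lookup sym (_ ∷ pairs) {suc i} {suc j} i≢j = AllPairs-lookup sym pairs (i≢j ∘ cong suc)

  module _ {A B : Set} (f : A → Maybe B) where

    mapMaybe-All : ∀ {P : B → Set} xs → (∀ {x y} → x ∈ xs → f x ≡ just y → P y) → All P (mapMaybe f xs)
    mapMaybe-All []       _ = []
    mapMaybe-All (x ∷ xs) h with f x in fx
    ... | just y  = h (here refl) fx ∷ mapMaybe-All xs (h ∘ there)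
    ... | nothing = mapMaybe-All xs (h ∘ there)

    ∈-mapMaybe⁺ : ∀ {xs x y} → x ∈ xs → f x ≡ just y → y ∈ mapMaybe f xs
    ∈-mapMaybe⁺ {x ∷ xs}  (here refl) fx rewrite fx = here refl
    ∈-mapMaybe⁺ {x′ ∷ xs} (there x∈)  fx with f x′
    ... | just _  = there (∈-mapMaybe⁺ x∈ fx)
    ... | nothing = ∈-mapMaybe⁺ x∈ fx

  length-mapMaybe-disjoint : ∀ {A B C : Set} (f : A → Maybe B) (g : A → Maybe C) xs →
                             (∀ {x b c} → x ∈ xs → f x ≡ just b → g x ≡ just c → ⊥) →
                             length (mapMaybe f xs) + length (mapMaybe g xs) ≤ length xs
  length-mapMaybe-disjoint f g []       _        = z≤n
  length-mapMaybe-disjoint f g (x ∷ xs) disjoint with f x in fx | g x in gx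
  ... | just _  | just _  = ⊥-elim (disjoint (here refl) fx gx)
  ... | just _  | nothing = s≤s (length-mapMaybe-disjoint f g xs (disjoint ∘ there))
  ... | nothing | just _  = ≤-trans (≤-reflexive (+-suc _ _)) (s≤s (length-mapMaybe-disjoint f g xs (disjoint ∘ there)))
  ... | nothing | nothing = m≤n⇒m≤1+n (length-mapMaybe-disjoint f g xs (disjoint ∘ there))

  snoc : ∀ {n} {D : Digraph n} {u v w} → Walk⁺ D u v → Arc D v w → Walk⁺ D u w
  snoc (one uv)    vw = uv ∷ one vw
  snoc (uv ∷ walk) vw = uv ∷ snoc walk vw

  converse : ∀ {n} → Digraph n → Digraph n
  converse D u v = D v u

  converse-walk : ∀ {n} {D : Digraph n} {u v} → Walk⁺ (converse D) u v → Walk⁺ D v u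
  converse-walk (one vu)    = one vu
  converse-walk (vu ∷ walk) = snoc (converse-walk walk) vu

  converse-acyclic : ∀ {n} {D : Digraph n} → Acyclic D → Acyclic (converse D)
  converse-acyclic acyclic v = acyclic v ∘ converse-walk

  module _ {n} {D : Digraph n} (acyclic : Acyclic D) (S : Fin n → Bool) where

    successor-closed-empty : (∀ x → S x ≡ true → ∃ λ w → S w ≡ true × Arc D x w) → ∀ {v} → S v ≡ true → ⊥
    successor-closed-empty next {v} v∈S =
      let i , j , i<j , same = pigeonhole (n<1+n n) (λ i → proj₁ (path (toℕ i)))
      in acyclic _ (subst (Walk⁺ D _) (sym same) (walk i<j))
      where
        path : ℕ → Σ (Fin n) λ x → S x ≡ true
        path zero    = v , v∈S
        path (suc i) = proj₁ (next _ (proj₂ (path i))) , proj₁ (proj₂ (next _ (proj₂ (path i))))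

        walk : ∀ {i j} → i < j → Walk⁺ D (proj₁ (path i)) (proj₁ (path j))
        walk {i} {suc j} (s≤s i≤j) with m≤n⇒m<n∨m≡n i≤j
        ... | inj₁ i<j  = snoc (walk i<j) (proj₂ (proj₂ (next _ (proj₂ (path j)))))
        ... | inj₂ refl = one (proj₂ (proj₂ (next _ (proj₂ (path i)))))

    sink : ∀ {v} → S v ≡ true → ∃ λ x → S x ≡ true × ∀ w → S w ≡ true → D x w ≡ false
    sink v∈S with any? (λ x → S x ≟ᵇ true ×-dec all? (λ w → S w ≟ᵇ true →-dec D x w ≟ᵇ false))
    ... | yes found = found
    ... | no none = ⊥-elim (successor-closed-empty next v∈S)
      where
        next : ∀ x → S x ≡ true → ∃ λ w → S w ≡ true × Arc D x w
        next x x∈S with ¬∀⟶∃¬ n _ (λ w → S w ≟ᵇ true →-dec D x w ≟ᵇ false)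
                                 (λ x-sink → none (x , x∈S , x-sink))
        ... | w , ¬edge with S w in w∈S | D x w in xw
        ... | true  | true  = w , w∈S , xw
        ... | true  | false = contradiction (λ _ → refl) ¬edge
        ... | false | _     = contradiction (λ ()) ¬edge

  rank-acyclic : ∀ {n} {D : Digraph n} (rank : Fin n → ℕ) → (∀ {u v} → Arc D u v → rank u < rank v) → Acyclic D
  rank-acyclic {D = D} rank increasing v walk = n≮n _ (along walk)
    where
      along : ∀ {u w} → Walk⁺ D u w → rank u < rank w
      along (one uw)    = increasing uw
      along (uv ∷ walk) = <-trans (increasing uv) (along walk)

  -- Greedy colouring

  imageOf : ∀ {n} → (Fin n → Bool) → (Fin n → ℕ) → ℕ → Bool
  imageOf {zero}  P col c = false
  imageOf {suc n} P col c = (P zero ∧ does (c ≟ col zero)) ∨ imageOf (P ∘ suc) (col ∘ suc) c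

  imageOf-complete : ∀ {n} (P : Fin n → Bool) col {u} → P u ≡ true → imageOf P col (col u) ≡ true
  imageOf-complete P col {zero} Pu rewrite Pu | dec-true (col zero ≟ col zero) refl = refl
  imageOf-complete P col {suc u} Pu with P zero ∧ does (col (suc u) ≟ col zero)
  ... | true  = refl
  ... | false = imageOf-complete (P ∘ suc) (col ∘ suc) Pu

  count-imageOf : ∀ {n a} (P : Fin n → Bool) col → count {a} (λ c → imageOf P col (toℕ c)) ≤ count P
  count-imageOf {zero} {a} P col = ≤-reflexive (count-false {a} _ λ _ → refl)
  count-imageOf {suc n} {a} P col with P zero
  ... | true  = ≤-trans (count-∨ {a} (λ c → does (toℕ c ≟ col zero)) (λ c → imageOf (P ∘ suc) (col ∘ suc) (toℕ c)))
                        (+-mono-≤ (count-singleton {a} (col zero)) (count-imageOf {a = a} (P ∘ suc) (col ∘ suc)))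
  ... | false = ≤-trans (count-∨ {a} (λ _ → false) (λ c → imageOf (P ∘ suc) (col ∘ suc) (toℕ c)))
                        (+-mono-≤ (≤-reflexive (count-false {a} _ λ _ → refl))
                                  (count-imageOf {a = a} (P ∘ suc) (col ∘ suc)))

  free-colour : ∀ {n a} (P : Fin n → Bool) (col : Fin n → ℕ) → count P < a →
                ∃ λ c → c < a × ∀ u → P u ≡ true → col u ≢ c
  free-colour {a = a} P col |P|<a
    with count<n⇒∃false (λ c → imageOf P col (toℕ c)) (≤-<-trans (count-imageOf {a = a} P col) |P|<a)
  ... | c , unused = toℕ c , toℕ<n c , λ u Pu col≡c →
    contradiction (trans (sym (subst (λ c′ → imageOf P col c′ ≡ true) col≡c (imageOf-complete P col Pu))) unused) λ ()

  Colouring : ∀ {n} → Digraph n → (Fin n → Bool) → ℕ → Set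
  Colouring {n} D S a = Σ (Fin n → ℕ) λ col → (∀ v → S v ≡ true → col v < a)
                                            × (∀ u v → S u ≡ true → S v ≡ true → Arc D u v → col u ≢ col v)

  module _ {n} {D : Digraph n} (acyclic : Acyclic D) (a : ℕ) where

    private
      empty-colouring : ∀ {S} → (∀ v → S v ≡ true → ⊥) → Colouring D S a
      empty-colouring ∄ = (λ _ → 0) , (λ v → ⊥-elim ∘ ∄ v) , (λ u _ u∈S → ⊥-elim (∄ u u∈S))

      colour-by-size : ∀ m S → count S ≤ m → (∀ v → S v ≡ true → count (λ u → S u ∧ D u v) < a) →
                       Colouring D S a
      colour-by-size zero S |S|≤0 _ = empty-colouring λ v v∈S → contradiction (≤-trans (count-remove S v∈S) |S|≤0) λ ()
      colour-by-size (suc m) S |S|≤m indeg< with any? (λ v → S v ≟ᵇ true)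
      ... | no ∄v = empty-colouring λ v v∈S → ∄v (v , v∈S)
      ... | yes (_ , v∈S) with sink acyclic S v∈S
      -- Colour S without the sink x first; x then only has to avoid the colours of its in-neighbours.
      ... | x , x∈S , x-sink = col , col< , proper
        where
          S′ : Fin n → Bool
          S′ i = S i ∧ not (does (i Finₚ.≟ x))

          S′⊆S : ∀ i → S′ i ≡ true → S i ≡ true
          S′⊆S i = ∧-conicalˡ _ _

          into-S′ : ∀ {i} → S i ≡ true → i ≢ x → S′ i ≡ true
          into-S′ {i} i∈S i≢x rewrite i∈S | dec-false (i Finₚ.≟ x) i≢x = refl

          rest : Colouring D S′ a
          rest = colour-by-size m S′ (≤-pred (≤-trans (count-remove S x∈S) |S|≤m))
                   λ v v∈S′ → ≤-<-trans (count-mono λ u → ∧-monoˡ-true (S′⊆S u)) (indeg< v (S′⊆S v v∈S′))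

          fresh : ∃ λ c → c < a × ∀ u → S′ u ∧ D u x ≡ true → proj₁ rest u ≢ c
          fresh = free-colour (λ u → S′ u ∧ D u x) (proj₁ rest)
                    (≤-<-trans (count-mono λ u → ∧-monoˡ-true (S′⊆S u)) (indeg< x x∈S))

          col : Fin n → ℕ
          col i = if does (i Finₚ.≟ x) then proj₁ fresh else proj₁ rest i

          col< : ∀ v → S v ≡ true → col v < a
          col< v v∈S with v Finₚ.≟ x
          ... | yes _   = proj₁ (proj₂ fresh)
          ... | no v≢x = proj₁ (proj₂ rest) v (into-S′ v∈S v≢x)

          proper : ∀ u v → S u ≡ true → S v ≡ true → Arc D u v → col u ≢ col v
          proper u v u∈S v∈S uv with u Finₚ.≟ x | v Finₚ.≟ x
          ... | yes refl | _        = contradiction (trans (sym uv) (x-sink v v∈S)) λ ()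
          ... | no u≢x   | yes refl = proj₂ (proj₂ fresh) u (∧-intro (into-S′ u∈S u≢x) uv)
          ... | no u≢x   | no v≢x   = proj₂ (proj₂ rest) u v (into-S′ u∈S u≢x) (into-S′ v∈S v≢x) uv

    greedy-colouring : ∀ S → (∀ v → S v ≡ true → count (λ u → S u ∧ D u v) < a) → Colouring D S a
    greedy-colouring S = colour-by-size n S (count≤n S)

  bounded-degree-colouring : ∀ {n} {D : Digraph n} → Acyclic D → ∀ a b → (∀ v → indeg D v < a ⊎ outdeg D v < b) →
                             Σ (Fin n → ℕ) λ col → (∀ v → col v < a + b) × (∀ u v → Arc D u v → col u ≢ col v)
  bounded-degree-colouring {n} {D} acyclic a b degree = col , col< , proper
    where
      low-in : Fin n → Bool
      low-in v = does (indeg D v <? a)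

      low-out : ∀ v → low-in v ≡ false → outdeg D v < b
      low-out v high-in with degree v
      ... | inj₁ in<a  = contradiction (trans (sym (dec-true (indeg D v <? a) in<a)) high-in) λ ()
      ... | inj₂ out<b = out<b

      by-in : Colouring D low-in a
      by-in = greedy-colouring acyclic a low-in λ v v∈ →
        ≤-<-trans (count-∧≤ʳ low-in (λ u → D u v)) (from-does (indeg D v <? a) v∈)

      by-out : Colouring (converse D) (not ∘ low-in) b
      by-out = greedy-colouring (converse-acyclic acyclic) b (not ∘ low-in) λ v v∈ →
        ≤-<-trans (count-∧≤ʳ (not ∘ low-in) (D v)) (low-out v (not-injective v∈))

      col : Fin n → ℕ
      col v = if low-in v then proj₁ by-in v else a + proj₁ by-out v

      col< : ∀ v → col v < a + b
      col< v with low-in v in v∈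
      ... | true  = ≤-trans (proj₁ (proj₂ by-in) v v∈) (m≤m+n a b)
      ... | false = +-monoʳ-< a (proj₁ (proj₂ by-out) v (cong not v∈))

      proper : ∀ u v → Arc D u v → col u ≢ col v
      proper u v uv with low-in u in u∈ | low-in v in v∈
      ... | true  | true  = proj₂ (proj₂ by-in) u v u∈ v∈ uv
      ... | false | false = proj₂ (proj₂ by-out) v u (cong not v∈) (cong not u∈) uv ∘ sym ∘ +-cancelˡ-≡ a _ _
      ... | true  | false = <⇒≢ (≤-trans (proj₁ (proj₂ by-in) u u∈) (m≤m+n a _))
      ... | false | true  = ≢-sym (<⇒≢ (≤-trans (proj₁ (proj₂ by-in) v v∈) (m≤m+n a _)))

  -- Cuts and labellings

  transpose : ∀ {m n} → (Fin m → Subset n) → Fin n → Subset m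
  transpose U x = tabulate λ a → lookup (U a) x

  ∈-transpose⁺ : ∀ {m n} (U : Fin m → Subset n) {a x} → x ∈ₛ U a → a ∈ₛ transpose U x
  ∈-transpose⁺ U {a} {x} x∈Ua = lookup⇒[]= a (transpose U x) (trans (lookup∘tabulate _ a) ([]=⇒lookup x∈Ua))

  ∈-transpose⁻ : ∀ {m n} (U : Fin m → Subset n) {a x} → a ∈ₛ transpose U x → x ∈ₛ U a
  ∈-transpose⁻ U {a} {x} a∈Ux = lookup⇒[]= x (U a) (trans (sym (lookup∘tabulate _ a)) ([]=⇒lookup a∈Ux))

  ⊈⇒∃ : ∀ {n} {p q : Subset n} → p ⊈ q → ∃ λ x → x ∈ₛ p × x ∉ₛ q
  ⊈⇒∃ {n} {p} {q} p⊈q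
    with ¬∀⟶∃¬ n (λ x → x ∈ₛ p → x ∈ₛ q) (λ x → x ∈? p →-dec x ∈? q) (λ p⊆q → p⊈q (p⊆q _))
  ... | x , escapes with x ∈? p
  ...   | yes x∈p = x , x∈p , escapes ∘ const
  ...   | no  x∉p = contradiction (⊥-elim ∘ x∉p) escapes

  Labelling : ℕ → ∀ {n} → Digraph n → Set
  Labelling k {n} D = Σ (Fin n → Subset k) λ label → ∀ u v → Arc D u v → label u ⊈ label v

  labelling⇒covered : ∀ {k n} {D : Digraph n} → Labelling k D → CoveredBy k D
  labelling⇒covered (label , separates) = transpose label , λ u v uv →
    let a , a∈ , a∉ = ⊈⇒∃ (separates u v uv)
    in  a , ∈-transpose⁺ label a∈ , a∉ ∘ ∈-transpose⁻ label

  covered⇒labelling : ∀ {k n} {D : Digraph n} → CoveredBy k D → Labelling k D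
  covered⇒labelling (U , cut) = transpose U , λ u v uv ⊆ →
    let a , u∈Ua , v∉Ua = cut u v uv
    in  v∉Ua (∈-transpose⁻ U (⊆ (∈-transpose⁺ U u∈Ua)))

  converse-covered : ∀ {k n} {D : Digraph n} → CoveredBy k (converse D) → CoveredBy k D
  converse-covered (U , cut) = ∁ ∘ U , λ u v uv →
    let a , v∈Ua , u∉Ua = cut v u uv
    in  a , x∉p⇒x∈∁p u∉Ua , x∈p⇒x∉∁p v∈Ua

  -- The middle layer

  Incomparable : ∀ {n} → Rel (Subset n) 0ℓ
  Incomparable x y = x ⊈ y × y ⊈ x

  layer : (n j : ℕ) → List (Subset n)
  layer zero    zero    = [] ∷ []
  layer zero    (suc j) = []
  layer (suc n) zero    = map (outside ∷_) (layer n zero)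
  layer (suc n) (suc j) = map (outside ∷_) (layer n (suc j)) ++ map (inside ∷_) (layer n j)

  length-layer : ∀ n j → length (layer n j) ≡ n C j
  length-layer zero    zero    = refl
  length-layer zero    (suc j) = refl
  length-layer (suc n) zero    = trans (length-map _ (layer n zero)) (length-layer n zero)
  length-layer (suc n) (suc j) = begin
    length (map (outside ∷_) (layer n (suc j)) ++ map (inside ∷_) (layer n j))
      ≡⟨ length-++ (map (outside ∷_) (layer n (suc j))) ⟩
    length (map (outside ∷_) (layer n (suc j))) + length (map (inside ∷_) (layer n j))
      ≡⟨ cong₂ _+_ (trans (length-map _ (layer n (suc j))) (length-layer n (suc j)))
                   (trans (length-map _ (layer n j)) (length-layer n j)) ⟩
    n C suc j + n C j
      ≡⟨ +-comm (n C suc j) (n C j) ⟩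
    n C j + n C suc j
      ≡⟨ nCk+nC[k+1]≡[n+1]C[k+1] n j ⟩
    suc n C suc j ∎
    where open ≡-Reasoning

  size-layer : ∀ n j {x} → x ∈ layer n j → ∣ x ∣ ≡ j
  size-layer zero    zero    (here refl) = refl
  size-layer (suc n) zero    x∈ with ∈-map⁻ _ x∈
  ... | y , y∈ , refl = size-layer n zero y∈
  size-layer (suc n) (suc j) x∈ with ∈-++⁻ (map (outside ∷_) (layer n (suc j))) x∈
  ... | inj₁ x∈₀ with ∈-map⁻ _ x∈₀
  ...   | y , y∈ , refl = size-layer n (suc j) y∈
  size-layer (suc n) (suc j) x∈ | inj₂ x∈₁ with ∈-map⁻ _ x∈₁
  ...   | y , y∈ , refl = cong suc (size-layer n j y∈)

  ∷-incomparable : ∀ {n b} {x y : Subset n} → Incomparable x y → Incomparable (b ∷ x) (b ∷ y)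
  ∷-incomparable (x⊈y , y⊈x) = x⊈y ∘ drop-∷-⊆ , y⊈x ∘ drop-∷-⊆

  layer-antichain : ∀ n j → AllPairs Incomparable (layer n j)
  layer-antichain zero    zero    = [] ∷ []
  layer-antichain zero    (suc j) = []
  layer-antichain (suc n) zero    = AllPairs.map⁺ (AllPairs.map ∷-incomparable (layer-antichain n zero))
  layer-antichain (suc n) (suc j) = AllPairs.++⁺
    (AllPairs.map⁺ (AllPairs.map ∷-incomparable (layer-antichain n (suc j))))
    (AllPairs.map⁺ (AllPairs.map ∷-incomparable (layer-antichain n j)))
    (All.map⁺ (All.tabulate λ x∈ → All.map⁺ (All.tabulate λ y∈ → across x∈ y∈)))
    where
      across : ∀ {x y} → x ∈ layer n (suc j) → y ∈ layer n j → Incomparable (outside ∷ x) (inside ∷ y)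
      across x∈ y∈ = (λ ⊆ → n≮n j (subst₂ _≤_ (size-layer n (suc j) x∈) (size-layer n j y∈)
                                              (p⊆q⇒∣p∣≤∣q∣ (drop-∷-⊆ ⊆))))
                   , (λ ⊆ → case ⊆ Vec.here of λ ())

  colouring⇒covered : ∀ {k n} {D : Digraph n} (col : Fin n → ℕ) → (∀ v → col v < M k) →
                      (∀ u v → Arc D u v → col u ≢ col v) → CoveredBy k D
  colouring⇒covered {k} {n} {D} col col<M proper = labelling⇒covered (label , separates)
    where
      index : Fin n → Fin (length (layer k (k / 2)))
      index v = fromℕ< (subst (col v <_) (sym (length-layer k (k / 2))) (col<M v))

      label : Fin n → Subset k
      label = List.lookup (layer k (k / 2)) ∘ index

      separates : ∀ u v → Arc D u v → label u ⊈ label v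
      separates u v uv = proj₁ (AllPairs-lookup swap (layer-antichain k (k / 2)) λ same →
        proper u v uv (trans (sym (toℕ-fromℕ< _)) (trans (cong toℕ same) (toℕ-fromℕ< _))))

  upper-bound : ∀ k a b → a + b ≤ M k → ∀ {n} {D : Digraph n} → Acyclic D →
                (∀ v → indeg D v < a ⊎ outdeg D v < b) → CoveredBy k D
  upper-bound k a b a+b≤M acyclic degree =
    let col , col< , proper = bounded-degree-colouring acyclic a b degree
    in  colouring⇒covered col (λ v → <-≤-trans (col< v) a+b≤M) proper

  -- Symmetric chains

  -- base is the size of the bottom element; it is recorded only to count chains by layer.
  record SymmetricChain (n : ℕ) : Set where
    constructor chain
    field
      base       : ℕ
      top        : Subset n
      rest       : List (Subset n)
      descending : AllPairs _⊇_ (top ∷ rest)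
      symmetric  : base * 2 + length rest ≡ n

  open SymmetricChain

  elements : ∀ {n} → SymmetricChain n → List (Subset n)
  elements c = top c ∷ rest c

  extend : ∀ {n} → SymmetricChain n → SymmetricChain (suc n)
  extend (chain s x ys (x⊇ys ∷ desc) symmetric) = chain s (inside ∷ x) (map (outside ∷_) (x ∷ ys))
    (All.map⁺ (All.map out⊆ (⊆-refl ∷ x⊇ys)) ∷ AllPairs.map⁺ (AllPairs.map s⊆s (x⊇ys ∷ desc)))
    (trans (cong (s * 2 +_) (length-map _ (x ∷ ys))) (trans (+-suc _ _) (cong suc symmetric)))

  split : ∀ {n} → SymmetricChain n → List (SymmetricChain (suc n))
  split (chain s x []       _                 _)         = []
  split (chain s x (y ∷ ys) (_ ∷ y⊇ys ∷ desc) symmetric) = chain (suc s) (inside ∷ y) (map (inside ∷_) ys)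
    (AllPairs.map⁺ (AllPairs.map s⊆s (y⊇ys ∷ desc)))
    (cong suc (trans (cong (suc (s * 2) +_) (length-map _ ys)) (trans (sym (+-suc _ _)) symmetric))) ∷ []

  grow : ∀ {n} → SymmetricChain n → List (SymmetricChain (suc n))
  grow c = extend c ∷ split c

  symmetricChains : (n : ℕ) → List (SymmetricChain n)
  symmetricChains zero    = chain 0 [] [] ([] ∷ []) refl ∷ []
  symmetricChains (suc n) = List.concatMap grow (symmetricChains n)

  symmetricChains-cover : ∀ n (x : Subset n) → Any ((x ∈_) ∘ elements) (symmetricChains n)
  symmetricChains-cover zero    []      = here (here refl)
  symmetricChains-cover (suc n) (b ∷ x) = Any.concatMap⁺ grow (Any.map (grown b) (symmetricChains-cover n x))
    where
      grown : ∀ b {c} → x ∈ elements c → Any ((b ∷ x ∈_) ∘ elements) (grow c)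
      grown outside {chain _ _ _       (_ ∷ _)     _} x∈                 = here (there (∈-map⁺ _ x∈))
      grown inside  {chain _ _ _       (_ ∷ _)     _} (here refl)        = here (here refl)
      grown inside  {chain _ _ (_ ∷ _) (_ ∷ _ ∷ _) _} (there (here refl)) = there (here (here refl))
      grown inside  {chain _ _ (_ ∷ _) (_ ∷ _ ∷ _) _} (there (there x∈)) = there (here (there (∈-map⁺ _ x∈)))

  inInterval : ℕ → ℕ → ℕ → ℕ
  inInterval zero    l       zero    = 1
  inInterval zero    zero    (suc j) = 0
  inInterval zero    (suc l) (suc j) = inInterval zero l j
  inInterval (suc s) l       zero    = 0
  inInterval (suc s) l       (suc j) = inInterval s l j

  inInterval-zero : ∀ s l l′ → inInterval s l 0 ≡ inInterval s l′ 0
  inInterval-zero zero    l l′ = refl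
  inInterval-zero (suc s) l l′ = refl

  inInterval-grow₀ : ∀ s j → inInterval s 1 (suc j) ≡ inInterval s 0 (suc j) + inInterval s 0 j
  inInterval-grow₀ zero    zero    = refl
  inInterval-grow₀ zero    (suc j) = refl
  inInterval-grow₀ (suc s) zero    = trans (inInterval-zero s 1 0) (sym (+-identityʳ _))
  inInterval-grow₀ (suc s) (suc j) = inInterval-grow₀ s j

  inInterval-grow : ∀ s l j → inInterval s (2 + l) (suc j) + inInterval s l j
                            ≡ inInterval s (suc l) (suc j) + inInterval s (suc l) j
  inInterval-grow zero    l zero    = +-comm (inInterval zero (suc l) zero) _
  inInterval-grow zero    l (suc j) = +-comm (inInterval zero (suc l) (suc j)) _
  inInterval-grow (suc s) l zero    = cong (_+ 0) (inInterval-zero s (2 + l) (suc l))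
  inInterval-grow (suc s) l (suc j) = inInterval-grow s l j

  inInterval-one : ∀ {s l j} → s ≤ j → j ≤ s + l → inInterval s l j ≡ 1
  inInterval-one {zero}  {l}     {zero}  _         _         = refl
  inInterval-one {zero}  {suc l} {suc j} _         (s≤s j≤l) = inInterval-one {zero} z≤n j≤l
  inInterval-one {suc s} {l}     {suc j} (s≤s s≤j) (s≤s j≤) = inInterval-one s≤j j≤

  meets : ∀ {n} → ℕ → SymmetricChain n → ℕ
  meets j c = inInterval (base c) (length (rest c)) j

  rankCount : ∀ {n} → ℕ → List (SymmetricChain n) → ℕ
  rankCount j = sum ∘ map (meets j)

  rankCount-++ : ∀ {n} j (xs ys : List (SymmetricChain n)) → rankCount j (xs ++ ys) ≡ rankCount j xs + rankCount j ys
  rankCount-++ j xs ys = trans (cong sum (map-++ (meets j) xs ys)) (sum-++ (map (meets j) xs) _)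

  rankCount-grow-zero : ∀ {n} (c : SymmetricChain n) → rankCount 0 (grow c) ≡ meets 0 c
  rankCount-grow-zero (chain s x []       (_ ∷ _)     _) = trans (+-identityʳ _) (inInterval-zero s _ _)
  rankCount-grow-zero (chain s x (y ∷ ys) (_ ∷ _ ∷ _) _) = trans (+-identityʳ _) (inInterval-zero s _ _)

  rankCount-grow-suc : ∀ {n} j (c : SymmetricChain n) → rankCount (suc j) (grow c) ≡ meets (suc j) c + meets j c
  rankCount-grow-suc j (chain s x []       (_ ∷ _)     _) = trans (+-identityʳ _) (inInterval-grow₀ s j)
  rankCount-grow-suc j (chain s x (y ∷ ys) (_ ∷ _ ∷ _) _) =
    trans (cong₂ (λ l l′ → inInterval s (2 + l) (suc j) + (inInterval s l′ j + 0)) (length-map _ ys) (length-map _ ys))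
          (trans (cong (inInterval s (2 + length ys) (suc j) +_) (+-identityʳ _)) (inInterval-grow s (length ys) j))

  rankCount-symmetricChains : ∀ n j → rankCount j (symmetricChains n) ≡ n C j
  rankCount-symmetricChains zero    zero    = refl
  rankCount-symmetricChains zero    (suc j) = refl
  rankCount-symmetricChains (suc n) zero    = trans (grown (symmetricChains n)) (rankCount-symmetricChains n zero)
    where
      grown : ∀ cs → rankCount 0 (List.concatMap grow cs) ≡ rankCount 0 cs
      grown []       = refl
      grown (c ∷ cs) = trans (rankCount-++ 0 (grow c) _) (cong₂ _+_ (rankCount-grow-zero c) (grown cs))
  rankCount-symmetricChains (suc n) (suc j) = begin
    rankCount (suc j) (symmetricChains (suc n))                      ≡⟨ grown (symmetricChains n) ⟩
    rankCount (suc j) (symmetricChains n) + rankCount j (symmetricChains n)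
      ≡⟨ cong₂ _+_ (rankCount-symmetricChains n (suc j)) (rankCount-symmetricChains n j) ⟩
    n C suc j + n C j                                                  ≡⟨ +-comm (n C suc j) _ ⟩
    n C j + n C suc j                                                  ≡⟨ nCk+nC[k+1]≡[n+1]C[k+1] n j ⟩
    suc n C suc j                                                      ∎
    where
      open ≡-Reasoning
      grown : ∀ cs → rankCount (suc j) (List.concatMap grow cs) ≡ rankCount (suc j) cs + rankCount j cs
      grown []       = refl
      grown (c ∷ cs) = trans (rankCount-++ (suc j) (grow c) _)
        (trans (cong₂ _+_ (rankCount-grow-suc j c) (grown cs)) (interchange (meets (suc j) c) _ _ _))

  middle-rank : ∀ s l → s ≤ (s * 2 + l) / 2 × (s * 2 + l) / 2 ≤ s + l
  middle-rank s l = subst (_≤ (s * 2 + l) / 2) (m*n/n≡m s 2) (/-monoˡ-≤ 2 (m≤m+n (s * 2) l))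
                  , ≤-pred (m<n*o⇒m/o<n (s≤s (m≤n⇒m≤1+n (≤-trans (+-monoʳ-≤ (s * 2) (m≤m*n l 2))
                                                                 (≤-reflexive (sym (*-distribʳ-+ 2 s l)))))))

  meets-middle : ∀ {n} (c : SymmetricChain n) → meets (n / 2) c ≡ 1
  meets-middle (chain s _ ys _ symmetric) =
    let lower , upper = middle-rank s (length ys)
    in  inInterval-one (subst (λ n → s ≤ n / 2) symmetric lower) (subst (λ n → n / 2 ≤ s + length ys) symmetric upper)

  length-symmetricChains : ∀ n → length (symmetricChains n) ≡ M n
  length-symmetricChains n = trans (sym (middle (symmetricChains n))) (rankCount-symmetricChains n (n / 2))
    where
      middle : ∀ cs → rankCount (n / 2) cs ≡ length cs
      middle []       = refl
      middle (c ∷ cs) = cong₂ _+_ (meets-middle c) (middle cs)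

  M-mono : ∀ n → M n ≤ M (suc n)
  M-mono n = subst₂ _≤_ (length-symmetricChains n) (length-symmetricChains (suc n)) (grown (symmetricChains n))
    where
      grown : ∀ cs → length cs ≤ length (List.concatMap grow cs)
      grown []       = z≤n
      grown (c ∷ cs) = s≤s (≤-trans (grown cs) (subst (_ ≤_) (sym (length-++ (split c))) (m≤n+m _ (length (split c)))))

  record ChainCover (d : ℕ) : Set where
    field
      chains            : List (List (Subset d))
      chains-descending : All (AllPairs _⊇_) chains
      chains-cover      : ∀ x → Any (x ∈_) chains

  symmetricChainCover : ∀ n → ChainCover n
  symmetricChainCover n = record
    { chains            = map elements (symmetricChains n)
    ; chains-descending = All.map⁺ (All.tabulate λ {c} _ → SymmetricChain.descending c)
    ; chains-cover      = λ x → Any.map⁺ (symmetricChains-cover n x)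
    }

  size-symmetricChainCover : ∀ n → length (ChainCover.chains (symmetricChainCover n)) ≡ M n
  size-symmetricChainCover n = trans (length-map elements (symmetricChains n)) (length-symmetricChains n)

  -- Codes of lists

  triangle : ℕ → ℕ
  triangle zero    = 0
  triangle (suc s) = triangle s + suc s

  pair : ℕ → ℕ → ℕ
  pair a b = triangle (a + b) + a

  nextPair : ℕ × ℕ → ℕ × ℕ
  nextPair (a , zero)  = 0 , suc a
  nextPair (a , suc b) = suc a , b

  unpair : ℕ → ℕ × ℕ
  unpair zero    = 0 , 0
  unpair (suc c) = nextPair (unpair c)

  unpair-diagonal : ∀ s a b → a + b ≡ s → unpair (triangle s + a) ≡ (a , b)
  unpair-diagonal zero    zero    zero    _ = refl
  unpair-diagonal (suc s) zero    b       e = begin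
    unpair (triangle s + suc s + 0) ≡⟨ cong unpair (trans (+-identityʳ _) (+-suc (triangle s) s)) ⟩
    nextPair (unpair (triangle s + s)) ≡⟨ cong nextPair (unpair-diagonal s s 0 (+-identityʳ s)) ⟩
    (0 , suc s)                        ≡⟨ cong (0 ,_) (sym e) ⟩
    (0 , b)                            ∎
    where open ≡-Reasoning
  unpair-diagonal s       (suc a) b       e =
    trans (cong unpair (+-suc (triangle s) a)) (cong nextPair (unpair-diagonal s a (suc b) (trans (+-suc a b) e)))

  unpair-pair : ∀ a b → unpair (pair a b) ≡ (a , b)
  unpair-pair a b = unpair-diagonal (a + b) a b refl

  unpair-≤ : ∀ c → proj₁ (unpair c) ≤ c × proj₂ (unpair c) ≤ c
  unpair-≤ zero = z≤n , z≤n
  unpair-≤ (suc c) with unpair c | unpair-≤ c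
  ... | a , zero  | a≤c , _   = z≤n , s≤s a≤c
  ... | a , suc b | a≤c , b<c = s≤s a≤c , m≤n⇒m≤1+n (<⇒≤ b<c)

  pair-mono : ∀ {a a′ b b′} → a ≤ a′ → b ≤ b′ → pair a b ≤ pair a′ b′
  pair-mono a≤a′ b≤b′ = +-mono-≤ (triangle-mono (+-mono-≤ a≤a′ b≤b′)) a≤a′
    where
      triangle-mono : ∀ {s s′} → s ≤ s′ → triangle s ≤ triangle s′
      triangle-mono {zero}  _           = z≤n
      triangle-mono {suc s} (s≤s s≤s′) = +-mono-≤ (triangle-mono s≤s′) (s≤s s≤s′)

  encode : List ℕ → ℕ
  encode []       = 0
  encode (x ∷ xs) = suc (pair x (encode xs))

  decode : ℕ → ℕ → List ℕ
  decode zero    c       = []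
  decode (suc w) zero    = []
  decode (suc w) (suc c) = proj₁ (unpair c) ∷ decode w (proj₂ (unpair c))

  decode-encode : ∀ {w} xs → length xs ≤ w → decode w (encode xs) ≡ xs
  decode-encode {zero}  []       _         = refl
  decode-encode {suc w} []       _         = refl
  decode-encode {suc w} (x ∷ xs) (s≤s |xs|≤w) rewrite unpair-pair x (encode xs) = cong (x ∷_) (decode-encode xs |xs|≤w)

  length-decode : ∀ w c → length (decode w c) ≤ w
  length-decode zero    c       = z≤n
  length-decode (suc w) zero    = z≤n
  length-decode (suc w) (suc c) = s≤s (length-decode w _)

  ∈-decode : ∀ w c {x} → x ∈ decode w c → x < c
  ∈-decode (suc w) (suc c) (here refl) = s≤s (proj₁ (unpair-≤ c))
  ∈-decode (suc w) (suc c) (there x∈)  = m≤n⇒m≤1+n (<-≤-trans (∈-decode w _ x∈) (proj₂ (unpair-≤ c)))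

  encode≤ : ∀ {w m} xs → length xs ≤ w → All (_≤ m) xs → encode xs ≤ encode (List.replicate w m)
  encode≤ {w}     []       _            _           = z≤n
  encode≤ {suc w} (x ∷ xs) (s≤s |xs|≤w) (x≤m ∷ xs≤m) = s≤s (pair-mono x≤m (encode≤ xs |xs|≤w xs≤m))

  -- Exhausting the labels

  bit : Bool → Fin 2
  bit false = zero
  bit true  = suc zero

  subsetIndex : ∀ {d} → Subset d → Fin (2 ^ d)
  subsetIndex []      = zero
  subsetIndex (b ∷ p) = Fin.combine (bit b) (subsetIndex p)

  subsetIndex-injective : ∀ {d} {p p′ : Subset d} → subsetIndex p ≡ subsetIndex p′ → p ≡ p′
  subsetIndex-injective {p = []}    {[]}      _ = refl
  subsetIndex-injective {p = b ∷ p} {b′ ∷ p′} same =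
    cong₂ _∷_ (bit-injective (cong proj₁ parts)) (subsetIndex-injective (cong proj₂ parts))
    where
      parts : (bit b , subsetIndex p) ≡ (bit b′ , subsetIndex p′)
      parts = trans (sym (Finₚ.remQuot-combine _ _)) (trans (cong (Fin.remQuot _) same) (Finₚ.remQuot-combine _ _))

      bit-injective : ∀ {x y} → bit x ≡ bit y → x ≡ y
      bit-injective {false} {false} _ = refl
      bit-injective {true}  {true}  _ = refl

  labels-exhausted : ∀ {d} (enc : ℕ → Subset d) (level : ℕ → ℕ) → (∀ {s t} → s ≤ t → level s ≤ level t) →
                     (∀ t → t ≤ 2 ^ d → ∃ λ v → v < level (suc t) × ∀ u → u < level t → enc u ≢ enc v) → ⊥
  labels-exhausted {d} enc level level-mono fresh =
    let i , j , i<j , same = pigeonhole (n<1+n (2 ^ d)) (subsetIndex ∘ enc ∘ vertexAt)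
    in  new j (vertexAt i) (<-≤-trans (vertexAt< i) (level-mono i<j)) (subsetIndex-injective same)
    where
      fresh-at : (t : Fin (suc (2 ^ d))) →
                 ∃ λ v → v < level (suc (toℕ t)) × ∀ u → u < level (toℕ t) → enc u ≢ enc v
      fresh-at t = fresh (toℕ t) (≤-pred (toℕ<n t))

      vertexAt : Fin (suc (2 ^ d)) → ℕ
      vertexAt t = proj₁ (fresh-at t)

      vertexAt< : ∀ t → vertexAt t < level (suc (toℕ t))
      vertexAt< t = proj₁ (proj₂ (fresh-at t))

      new : ∀ t u → u < level (toℕ t) → enc u ≢ enc (vertexAt t)
      new t = proj₂ (proj₂ (fresh-at t))

  -- Universal digraphs

  data Kind : Set where
    In Out : Kind

  module Universal (kind : ℕ → Kind) (code : ℕ → ℕ) (p q : ℕ) where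

    EdgeBetween : Kind → Kind → ℕ → ℕ → Set
    EdgeBetween In  Out u v = ⊤
    EdgeBetween In  In  u v = u ∈ decode p (code v)
    EdgeBetween Out Out u v = v ∈ decode q (code u)
    EdgeBetween Out In  u v = ⊥

    Edge : ℕ → ℕ → Set
    Edge u v = EdgeBetween (kind u) (kind v) u v

    edgeBetween? : ∀ κ κ′ u v → Dec (EdgeBetween κ κ′ u v)
    edgeBetween? In  Out u v = yes tt
    edgeBetween? In  In  u v = u ∈ℕ? decode p (code v)
    edgeBetween? Out Out u v = v ∈ℕ? decode q (code u)
    edgeBetween? Out In  u v = no λ ()

    graph : (N : ℕ) → Digraph N
    graph N u v = does (edgeBetween? (kind (toℕ u)) (kind (toℕ v)) (toℕ u) (toℕ v))

    arc⇒edge : ∀ {N} {u v : Fin N} → Arc (graph N) u v → Edge (toℕ u) (toℕ v)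
    arc⇒edge = from-does (edgeBetween? _ _ _ _)

    edge⇒arc : ∀ {N} {u v : Fin N} → Edge (toℕ u) (toℕ v) → Arc (graph N) u v
    edge⇒arc = dec-true (edgeBetween? _ _ _ _)

    in→out : ∀ {u v} → kind u ≡ In → kind v ≡ Out → Edge u v
    in→out {u} {v} u-in v-out rewrite u-in | v-out = tt

    in→in : ∀ {u v} → kind u ≡ In → kind v ≡ In → u ∈ decode p (code v) → Edge u v
    in→in {u} {v} u-in v-in u∈ rewrite u-in | v-in = u∈

    out→out : ∀ {u v} → kind u ≡ Out → kind v ≡ Out → v ∈ decode q (code u) → Edge u v
    out→out {u} {v} u-out v-out v∈ rewrite u-out | v-out = v∈

    out-neighbour : ∀ κ κ′ {u v} → κ ≡ Out → EdgeBetween κ κ′ u v → v ∈ decode q (code u)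
    out-neighbour Out Out _ v∈ = v∈

    in-neighbour : ∀ κ κ′ {u v} → κ′ ≡ In → EdgeBetween κ κ′ u v → u ∈ decode p (code v)
    in-neighbour In In _ u∈ = u∈

    indeg≤ : ∀ {N} (v : Fin N) → kind (toℕ v) ≡ In → indeg (graph N) v ≤ p
    indeg≤ {N} v v-in = ≤-trans (count-mono λ u uv → dec-true (_ ∈ℕ? _) (in-neighbour _ _ v-in (arc⇒edge {u = u} uv)))
                            (≤-trans (count-∈ {N} (decode p (code (toℕ v)))) (length-decode p _))

    outdeg≤ : ∀ {N} (v : Fin N) → kind (toℕ v) ≡ Out → outdeg (graph N) v ≤ q
    outdeg≤ {N} v v-out = ≤-trans (count-mono λ w vw → dec-true (_ ∈ℕ? _)
                                                         (out-neighbour _ _ v-out (arc⇒edge {v = w} vw)))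
                              (≤-trans (count-∈ {N} (decode q (code (toℕ v)))) (length-decode q _))

    degree : ∀ {N} (v : Fin N) → indeg (graph N) v ≤ p ⊎ outdeg (graph N) v ≤ q
    degree v = by-kind (kind (toℕ v)) refl
      where
        by-kind : ∀ κ → kind (toℕ v) ≡ κ → indeg (graph _) v ≤ p ⊎ outdeg (graph _) v ≤ q
        by-kind In  v-in  = inj₁ (indeg≤ v v-in)
        by-kind Out v-out = inj₂ (outdeg≤ v v-out)

    module _ (code≤ : ∀ v → code v ≤ v) {N : ℕ} where

      rankOf : Kind → ℕ → ℕ
      rankOf In  v = v
      rankOf Out v = N + (N ∸ v)

      edgeBetween-rank : ∀ κ κ′ {u v} → u < N → EdgeBetween κ κ′ u v → rankOf κ u < rankOf κ′ v
      edgeBetween-rank In  Out u<N _  = ≤-trans u<N (m≤m+n N _)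
      edgeBetween-rank In  In  _   u∈ = <-≤-trans (∈-decode p _ u∈) (code≤ _)
      edgeBetween-rank Out Out u<N v∈ = +-monoʳ-< N (∸-monoʳ-< (<-≤-trans (∈-decode q _ v∈) (code≤ _)) (<⇒≤ u<N))

      graph-acyclic : Acyclic (graph N)
      graph-acyclic = rank-acyclic (λ v → rankOf (kind (toℕ v)) (toℕ v))
                                   λ {u} uv → edgeBetween-rank _ _ (toℕ<n u) (arc⇒edge uv)

    record Realizer (κ : Kind) : Set where
      field
        vertex      : ℕ → ℕ
        kind-vertex : ∀ c → kind (vertex c) ≡ κ
        code-vertex : ∀ c → code (vertex c) ≡ c
        vertex≤     : ∀ c → vertex c ≤ suc (c + c)

    room : ℕ → ℕ
    room m = encode (List.replicate p m) + encode (List.replicate q m)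

    nextLevel : ℕ → ℕ
    nextLevel m = m + suc (suc (room m + room m))

    level : ℕ → ℕ
    level zero    = 0
    level (suc t) = nextLevel (level t)

    level-mono : ∀ {s t} → s ≤ t → level s ≤ level t
    level-mono {t = zero}  z≤n = ≤-refl
    level-mono {t = suc t} s≤t with m≤n⇒m<n∨m≡n s≤t
    ... | inj₁ s<1+t = ≤-trans (level-mono (≤-pred s<1+t)) (m≤m+n (level t) _)
    ... | inj₂ refl  = ≤-refl

    below-nextLevel : ∀ {m c} → c ≤ room m → suc (c + c) < nextLevel m
    below-nextLevel {m} c≤room = ≤-trans (s≤s (s≤s (+-mono-≤ c≤room c≤room))) (m≤n+m _ m)

    labelling⇒separating : ∀ {N d} → Labelling d (graph N) →
                           Σ (ℕ → Subset d) λ enc → ∀ {u v} → u < N → v < N → Edge u v → enc u ⊈ enc v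
    labelling⇒separating {N} {d} (label , separates) = enc , λ {u} {v} u<N v<N uv →
      subst₂ _⊈_ (sym (enc-fromℕ< u<N)) (sym (enc-fromℕ< v<N))
        (separates _ _ (edge⇒arc (subst₂ Edge (sym (toℕ-fromℕ< u<N)) (sym (toℕ-fromℕ< v<N)) uv)))
      where
        enc : ℕ → Subset d
        enc u with u <? N
        ... | yes u<N = label (fromℕ< u<N)
        ... | no  _   = Vec.replicate d outside

        enc-fromℕ< : ∀ {u} (u<N : u < N) → enc u ≡ label (fromℕ< u<N)
        enc-fromℕ< {u} u<N with u <? N
        ... | yes _    = refl
        ... | no  u≮N  = contradiction u<N u≮N

    _≟ₖ_ : (κ κ′ : Kind) → Dec (κ ≡ κ′)
    In  ≟ₖ In  = yes refl
    In  ≟ₖ Out = no λ ()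
    Out ≟ₖ In  = no λ ()
    Out ≟ₖ Out = yes refl

    ofKind : Kind → Maybe ℕ → Maybe ℕ
    ofKind κ nothing  = nothing
    ofKind κ (just u) = if does (kind u ≟ₖ κ) then just u else nothing

    ofKind-just : ∀ κ x {u} → ofKind κ x ≡ just u → x ≡ just u × kind u ≡ κ
    ofKind-just κ (just u) e with kind u ≟ₖ κ | e
    ... | yes u-κ | refl = refl , u-κ

    ofKind-kind : ∀ {κ u} → kind u ≡ κ → ofKind κ (just u) ≡ just u
    ofKind-kind {κ} {u} u-κ rewrite dec-true (kind u ≟ₖ κ) u-κ = refl

    module Freshness {d} (enc : ℕ → Subset d) (N : ℕ)
                     (separates : ∀ {u v} → u < N → v < N → Edge u v → enc u ⊈ enc v)
                     (out-upward : ∀ {u v} → enc u ⊆ enc v → kind u ≡ Out → kind v ≡ Out)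
                     (cover : ChainCover d) where

      open ChainCover cover

      in-downward : ∀ {u v} → enc u ⊆ enc v → kind v ≡ In → kind u ≡ In
      in-downward {u} u⊆v v-in with kind u in u-kind
      ... | In  = refl
      ... | Out = contradiction (trans (sym v-in) (out-upward u⊆v u-kind)) λ ()

      Fresh : ℕ → Set
      Fresh m = ∃ λ v → v < nextLevel m × ∀ u → u < m → enc u ≢ enc v

      module _ (m : ℕ) (next≤N : nextLevel m ≤ N) where

        m≤N : m ≤ N
        m≤N = ≤-trans (m≤m+n m _) next≤N

        Present : Subset d → Set
        Present L = ∃ λ u → u < m × enc u ≡ L

        present? : ∀ L → Dec (Present L)
        present? L = anyUpTo? (λ u → ≡-dec _≟ᵇ_ (enc u) L) m

        highest : List (Subset d) → Maybe ℕ
        highest []       = nothing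
        highest (L ∷ ch) with present? L
        ... | yes (u , _) = just u
        ... | no  _       = highest ch

        lowest : List (Subset d) → Maybe ℕ
        lowest []       = nothing
        lowest (L ∷ ch) with lowest ch
        ... | just u  = just u
        ... | nothing with present? L
        ...   | yes (u , _) = just u
        ...   | no  _       = nothing

        highest-present : ∀ ch {u} → highest ch ≡ just u → u < m × enc u ∈ ch
        highest-present (L ∷ ch) e with present? L | e
        ... | yes (u , u<m , refl) | refl = u<m , here refl
        ... | no  _                | e′   = map₂ there (highest-present ch e′)

        highest-complete : ∀ {ch L} → L ∈ ch → Present L → ∃ λ u → highest ch ≡ just u
        highest-complete {L′ ∷ ch} L∈ present with present? L′
        ... | yes (u , _) = u , refl
        ... | no  absent with L∈
        ...   | here refl  = contradiction present absent
        ...   | there L∈ch = highest-complete L∈ch present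

        highest-dominates : ∀ {ch u} → AllPairs _⊇_ ch → highest ch ≡ just u →
                            ∀ {L} → L ∈ ch → Present L → L ⊆ enc u
        highest-dominates {L′ ∷ ch} (L′⊇ ∷ desc) e L∈ present with present? L′ | e
        ... | yes (u , _ , refl) | refl with L∈
        ...   | here refl  = ⊆-refl
        ...   | there L∈ch = All.lookup L′⊇ L∈ch
        highest-dominates {L′ ∷ ch} (L′⊇ ∷ desc) e L∈ present | no absent | e′ with L∈
        ...   | here refl  = contradiction present absent
        ...   | there L∈ch = highest-dominates desc e′ L∈ch present

        lowest-present : ∀ ch {u} → lowest ch ≡ just u → u < m × enc u ∈ ch
        lowest-present (L ∷ ch) e with lowest ch in low | e
        ... | just u  | refl = map₂ there (lowest-present ch low)
        ... | nothing | e′ with present? L | e′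
        ...   | yes (u , u<m , refl) | refl = u<m , here refl

        lowest-complete : ∀ {ch L} → L ∈ ch → Present L → ∃ λ u → lowest ch ≡ just u
        lowest-complete {L′ ∷ ch} L∈ present with lowest ch in low
        ... | just u  = u , refl
        ... | nothing with present? L′
        ...   | yes (u , _) = u , refl
        ...   | no  absent with L∈
        ...     | here refl  = contradiction present absent
        ...     | there L∈ch = contradiction (trans (sym low) (proj₂ (lowest-complete L∈ch present))) λ ()

        lowest-dominated : ∀ {ch u} → AllPairs _⊇_ ch → lowest ch ≡ just u →
                           ∀ {L} → L ∈ ch → Present L → enc u ⊆ L
        lowest-dominated {L′ ∷ ch} (L′⊇ ∷ desc) e L∈ present with lowest ch in low | e
        ... | just u | refl with L∈
        ...   | here refl  = All.lookup L′⊇ (proj₂ (lowest-present ch low))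
        ...   | there L∈ch = lowest-dominated desc low L∈ch present
        lowest-dominated {L′ ∷ ch} (L′⊇ ∷ desc) e L∈ present | nothing | e′ with present? L′ | e′
        ...   | yes (u , _ , refl) | refl with L∈
        ...     | here refl  = ⊆-refl
        ...     | there L∈ch = contradiction (trans (sym low) (proj₂ (lowest-complete L∈ch present))) λ ()

        topOuts : List ℕ
        topOuts = mapMaybe (ofKind Out ∘ highest) chains

        bottomIns : List ℕ
        bottomIns = mapMaybe (ofKind In ∘ lowest) chains

        topOuts≤ : All (_≤ m) topOuts
        topOuts≤ = mapMaybe-All _ chains λ {ch} _ e → <⇒≤ (proj₁ (highest-present ch (proj₁ (ofKind-just Out _ e))))

        bottomIns≤ : All (_≤ m) bottomIns
        bottomIns≤ = mapMaybe-All _ chains λ {ch} _ e → <⇒≤ (proj₁ (lowest-present ch (proj₁ (ofKind-just In _ e))))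

        tops-bottoms-disjoint : length topOuts + length bottomIns ≤ length chains
        tops-bottoms-disjoint = length-mapMaybe-disjoint _ _ chains λ {ch} ch∈ top bottom →
          let hi , r-out      = ofKind-just Out _ top
              lo , r′-in      = ofKind-just In _ bottom
              r<m , r∈ch      = highest-present ch hi
              r′<m , _        = lowest-present ch lo
          in  separates (<-≤-trans r′<m m≤N) (<-≤-trans r<m m≤N) (in→out r′-in r-out)
                        (lowest-dominated (All.lookup chains-descending ch∈) lo r∈ch (_ , r<m , refl))

        fresh-out : Realizer Out → length topOuts ≤ q → Fresh m
        fresh-out R |tops|≤q = vertex c , v<next , new
          where
            open Realizer R
            c : ℕ
            c = encode topOuts

            v<next : vertex c < nextLevel m
            v<next = ≤-<-trans (vertex≤ c)
                               (below-nextLevel (≤-trans (encode≤ topOuts |tops|≤q topOuts≤) (m≤n+m _ _)))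

            out-neighbours : decode q (code (vertex c)) ≡ topOuts
            out-neighbours = trans (cong (decode q) (code-vertex c)) (decode-encode topOuts |tops|≤q)

            new : ∀ u → u < m → enc u ≢ enc (vertex c)
            new u u<m same =
              let ch , ch∈ , v∈ch = find (chains-cover (enc (vertex c)))
                  r , hi          = highest-complete v∈ch (u , u<m , same)
                  r<m , _         = highest-present ch hi
                  v⊆r             = highest-dominates (All.lookup chains-descending ch∈) hi v∈ch (u , u<m , same)
                  r-out           = out-upward v⊆r (kind-vertex c)
                  r∈tops          = ∈-mapMaybe⁺ (ofKind Out ∘ highest) ch∈
                                                (trans (cong (ofKind Out) hi) (ofKind-kind r-out))
              in  separates (<-≤-trans v<next next≤N) (<-≤-trans r<m m≤N)
                            (out→out (kind-vertex c) r-out (subst (r ∈_) (sym out-neighbours) r∈tops)) v⊆r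

        fresh-in : Realizer In → length bottomIns ≤ p → Fresh m
        fresh-in R |bottoms|≤p = vertex c , x<next , new
          where
            open Realizer R
            c : ℕ
            c = encode bottomIns

            x<next : vertex c < nextLevel m
            x<next = ≤-<-trans (vertex≤ c)
                               (below-nextLevel (≤-trans (encode≤ bottomIns |bottoms|≤p bottomIns≤) (m≤m+n _ _)))

            in-neighbours : decode p (code (vertex c)) ≡ bottomIns
            in-neighbours = trans (cong (decode p) (code-vertex c)) (decode-encode bottomIns |bottoms|≤p)

            new : ∀ u → u < m → enc u ≢ enc (vertex c)
            new u u<m same =
              let ch , ch∈ , x∈ch = find (chains-cover (enc (vertex c)))
                  r , lo          = lowest-complete x∈ch (u , u<m , same)
                  r<m , _         = lowest-present ch lo
                  r⊆x             = lowest-dominated (All.lookup chains-descending ch∈) lo x∈ch (u , u<m , same)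
                  r-in            = in-downward r⊆x (kind-vertex c)
                  r∈bottoms       = ∈-mapMaybe⁺ (ofKind In ∘ lowest) ch∈
                                                (trans (cong (ofKind In) lo) (ofKind-kind r-in))
              in  separates (<-≤-trans r<m m≤N) (<-≤-trans x<next next≤N)
                            (in→in r-in (kind-vertex c) (subst (r ∈_) (sym in-neighbours) r∈bottoms)) r⊆x

  -- Lower bounds

  out-degree-lower-bound : ∀ k q → M k ≤ q →
                           Σ ℕ λ n → Σ (Digraph n) λ D → Acyclic D × (∀ v → outdeg D v ≤ q) × ¬ CoveredBy k D
  out-degree-lower-bound k q M≤q = N , graph N , graph-acyclic (λ _ → ≤-refl) , (λ v → outdeg≤ v refl) , uncovered
    where
      open Universal (λ _ → Out) (λ v → v) 0 q

      N : ℕ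
      N = level (suc (2 ^ k))

      identity : Realizer Out
      identity = record { vertex = λ c → c ; kind-vertex = λ _ → refl ; code-vertex = λ _ → refl
                        ; vertex≤ = λ c → m≤n⇒m≤1+n (m≤m+n c c) }

      uncovered : ¬ CoveredBy k (graph N)
      uncovered covered = labels-exhausted enc level level-mono λ t t≤2ᵏ →
        let next≤N = level-mono (s≤s t≤2ᵏ)
        in  fresh-out (level t) next≤N identity
              (≤-trans (length-mapMaybe _ chains) (≤-trans (≤-reflexive (size-symmetricChainCover k)) M≤q))
        where
          separating : Σ (ℕ → Subset k) λ enc → ∀ {u v} → u < N → v < N → Edge u v → enc u ⊈ enc v
          separating = labelling⇒separating (covered⇒labelling covered)

          enc : ℕ → Subset k
          enc = proj₁ separating

          open Freshness enc N (proj₂ separating) (λ _ _ → refl) (symmetricChainCover k)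
          open ChainCover (symmetricChainCover k)

  in-degree-lower-bound : ∀ k p → M k ≤ p →
                          Σ ℕ λ n → Σ (Digraph n) λ D → Acyclic D × (∀ v → indeg D v ≤ p) × ¬ CoveredBy k D
  in-degree-lower-bound k p M≤p =
    let n , D , acyclic , outdeg≤p , uncovered = out-degree-lower-bound k p M≤p
    in  n , converse D , converse-acyclic acyclic , outdeg≤p , uncovered ∘ converse-covered

  halve : ℕ → Kind × ℕ
  halve zero          = In , 0
  halve (suc zero)    = Out , 0
  halve (suc (suc v)) = map₂ suc (halve v)

  halve-≤ : ∀ v → proj₂ (halve v) ≤ v
  halve-≤ zero          = z≤n
  halve-≤ (suc zero)    = z≤n
  halve-≤ (suc (suc v)) = s≤s (m≤n⇒m≤1+n (halve-≤ v))

  halve-even : ∀ c → halve (c + c) ≡ (In , c)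
  halve-even zero    = refl
  halve-even (suc c) rewrite +-suc c c | halve-even c = refl

  halve-odd : ∀ c → halve (suc (c + c)) ≡ (Out , c)
  halve-odd zero    = refl
  halve-odd (suc c) rewrite +-suc c c | halve-odd c = refl

  kindBit : Kind → Bool
  kindBit In  = outside
  kindBit Out = inside

  head-⊆ : ∀ {n b c} {x y : Subset n} → b ∷ x ⊆ c ∷ y → b ≡ inside → c ≡ inside
  head-⊆ {c = inside}  _   _    = refl
  head-⊆ {c = outside} x⊆y refl = case x⊆y Vec.here of λ ()

  kindBit-inside : ∀ {κ} → kindBit κ ≡ inside → κ ≡ Out
  kindBit-inside {Out} _ = refl

  split-budget : ∀ {a b p q} → a + b ≤ suc (p + q) → a ≤ q ⊎ b ≤ p
  split-budget {a} {b} {p} {q} a+b≤ with a ≤? q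
  ... | yes a≤q = inj₁ a≤q
  ... | no  a≰q = inj₂ (+-cancelˡ-≤ (suc q) b p (≤-trans (+-monoˡ-≤ b (≰⇒> a≰q))
                                                        (≤-trans a+b≤ (≤-reflexive (cong suc (+-comm p q))))))

  mixed-lower-bound : ∀ k p q → M (suc k) ≤ suc (p + q) →
                      Σ ℕ λ n → Σ (Digraph n) λ D →
                        Acyclic D × (∀ v → indeg D v ≤ p ⊎ outdeg D v ≤ q) × ¬ CoveredBy k D
  mixed-lower-bound k p q M≤ = N , graph N , graph-acyclic halve-≤ , degree , uncovered
    where
      open Universal (proj₁ ∘ halve) (proj₂ ∘ halve) p q

      N : ℕ
      N = level (suc (2 ^ suc k))

      evens : Realizer In
      evens = record { vertex = λ c → c + c ; kind-vertex = cong proj₁ ∘ halve-even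
                     ; code-vertex = cong proj₂ ∘ halve-even ; vertex≤ = λ c → n≤1+n (c + c) }

      odds : Realizer Out
      odds = record { vertex = λ c → suc (c + c) ; kind-vertex = cong proj₁ ∘ halve-odd
                    ; code-vertex = cong proj₂ ∘ halve-odd ; vertex≤ = λ _ → ≤-refl }

      uncovered : ¬ CoveredBy k (graph N)
      uncovered covered = labels-exhausted enc level level-mono λ t t≤2ᵈ →
        let next≤N = level-mono (s≤s t≤2ᵈ)
        in  case split-budget (≤-trans (tops-bottoms-disjoint (level t) next≤N)
                                       (≤-trans (≤-reflexive (size-symmetricChainCover (suc k))) M≤)) of λ where
              (inj₁ tops≤q)    → fresh-out (level t) next≤N odds tops≤q
              (inj₂ bottoms≤p) → fresh-in (level t) next≤N evens bottoms≤p
        where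
          separating : Σ (ℕ → Subset k) λ label → ∀ {u v} → u < N → v < N → Edge u v → label u ⊈ label v
          separating = labelling⇒separating (covered⇒labelling covered)

          enc : ℕ → Subset (suc k)
          enc v = kindBit (proj₁ (halve v)) ∷ proj₁ separating v

          out-upward : ∀ {u v} → enc u ⊆ enc v → proj₁ (halve u) ≡ Out → proj₁ (halve v) ≡ Out
          out-upward u⊆v u-out = kindBit-inside (head-⊆ u⊆v (cong kindBit u-out))

          open Freshness enc N (λ u<N v<N uv → proj₂ separating u<N v<N uv ∘ drop-∷-⊆) out-upward
                         (symmetricChainCover (suc k))

open CutCovers using (M-mono; upper-bound; in-degree-lower-bound; out-degree-lower-bound; mixed-lower-bound)
open import Data.Nat using (ℕ; suc)
import Data.Nat as ℕ
import Data.Nat.Properties as ℕ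
open import Data.Integer using (ℤ; +_; -_; _+_; _-_; _≤_; _<_; _⊔_; -[1+_]; +≤+; -≤-)
open import Data.Integer.Properties using (drop‿+≤+; drop‿+<+; +-monoˡ-≤; +-monoˡ-<; +-assoc; +-inverseˡ; +-identityʳ; pos-+; ⊔-sel)
open import Function using (_∘_)
open import Data.Integer.Solver using (module +-*-Solver)
open import Data.Product using (∃; _×_; _,_)
open import Data.Sum using (inj₁; inj₂; [_,_]′)
import Data.Sum as Sum
open import Relation.Binary.PropositionalEquality using (_≡_; refl; trans; sym; cong; subst; subst₂)

shifted : ∀ Δ → - (+ 1) ≤ Δ → ∃ λ a → Δ ≡ + a - + 1
shifted (+ d)           _          = suc d , refl
shifted -[1+ 0 ]        _          = 0 , refl
shifted -[1+ suc _ ]    (-≤- ())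

minus-plus : ∀ i c → i - c + c ≡ i
minus-plus i c = trans (+-assoc i (- c) c) (trans (cong (λ j → i + j) (+-inverseˡ c)) (+-identityʳ i))

cancel-≤ : ∀ {a b} c → + a - c ≤ + b - c → a ℕ.≤ b
cancel-≤ {a} {b} c le = drop‿+≤+ (subst₂ _≤_ (minus-plus (+ a) c) (minus-plus (+ b) c) (+-monoˡ-≤ c le))

cancel-< : ∀ {a b} c → + a - c < + b - c → a ℕ.< b
cancel-< {a} {b} c lt = drop‿+<+ (subst₂ _<_ (minus-plus (+ a) c) (minus-plus (+ b) c) (+-monoˡ-< c lt))

sum-shifted : ∀ a b → (+ a - + 1) + (+ b - + 1) ≡ + (a ℕ.+ b) - + 2
sum-shifted a b = trans (solve 2 (λ x y → (x :- con (+ 1)) :+ (y :- con (+ 1)) := (x :+ y) :- con (+ 2)) refl (+ a) (+ b))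
                        (cong (_- + 2) (sym (pos-+ a b)))
  where open +-*-Solver

in-degree-exceeds : ∀ k a b → M k ℕ.< a → c> (+ a - + 1) (+ b - + 1) k
in-degree-exceeds k (suc p) b (ℕ.s≤s M≤p) =
  let n , D , acyclic , indeg≤p , uncovered = in-degree-lower-bound k p M≤p
  in  n , D , (acyclic , λ v → inj₁ (+≤+ (indeg≤p v))) , uncovered

out-degree-exceeds : ∀ k a b → M k ℕ.< b → c> (+ a - + 1) (+ b - + 1) k
out-degree-exceeds k a (suc q) (ℕ.s≤s M≤q) =
  let n , D , acyclic , outdeg≤q , uncovered = out-degree-lower-bound k q M≤q
  in  n , D , (acyclic , λ v → inj₂ (+≤+ (outdeg≤q v))) , uncovered

sum-exceeds : ∀ k a b → M (suc k) ℕ.< a ℕ.+ b → c> (+ a - + 1) (+ b - + 1) k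
sum-exceeds k 0       b       M<b   = out-degree-exceeds k 0 b (ℕ.≤-<-trans (M-mono k) M<b)
sum-exceeds k (suc p) 0       M<a   = in-degree-exceeds k (suc p) 0 (ℕ.≤-<-trans (M-mono k) (subst (M (suc k) ℕ.<_) (ℕ.+-identityʳ (suc p)) M<a))
sum-exceeds k (suc p) (suc q) M<a+b =
  let n , D , acyclic , degree , uncovered = mixed-lower-bound k p q (subst (M (suc k) ℕ.≤_) (ℕ.+-suc p q) (ℕ.≤-pred M<a+b))
  in  n , D , (acyclic , λ v → Sum.map +≤+ +≤+ (degree v)) , uncovered

theorem2p1 : (k : ℕ) → 1 Data.Nat.≤ k → (Δ⁻ Δ⁺ : ℤ) → - (+ 1) ≤ Δ⁻ → - (+ 1) ≤ Δ⁺ →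
      ((Δ⁻ + Δ⁺ ≤ + M k - + 2) → c≤ Δ⁻ Δ⁺ k)
    × ((+ M k - + 1 < Δ⁻ ⊔ Δ⁺) → c> Δ⁻ Δ⁺ k)
    × ((+ M (suc k) - + 2 < Δ⁻ + Δ⁺) → c> Δ⁻ Δ⁺ k)
theorem2p1 k _ Δ⁻ Δ⁺ Δ⁻≥-1 Δ⁺≥-1 with shifted Δ⁻ Δ⁻≥-1 | shifted Δ⁺ Δ⁺≥-1
... | a , refl | b , refl =
    (λ sum≤ n D (acyclic , degree) →
       upper-bound k a b (cancel-≤ (+ 2) (subst (_≤ _) (sum-shifted a b) sum≤)) acyclic
         (Sum.map (cancel-≤ (+ 1)) (cancel-≤ (+ 1)) ∘ degree))
  , (λ M<max → [ (λ max≡ → in-degree-exceeds k a b (cancel-< (+ 1) (subst (+ M k - + 1 <_) max≡ M<max)))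
               , (λ max≡ → out-degree-exceeds k a b (cancel-< (+ 1) (subst (+ M k - + 1 <_) max≡ M<max))) ]′
               (⊔-sel (+ a - + 1) (+ b - + 1)))
  , (λ M<sum → sum-exceeds k a b (cancel-< (+ 2) (subst (_ <_) (sum-shifted a b) M<sum)))
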